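{- Let $\mathcal{P}$ be a client/server system with a fixed linear order on its actions, and consider the following procedure. Nodes are pairs of a global state $s(n)$ of $\mathrm{TS}(\mathcal{P})$ and a set of actions $\mathit{sleep}(n)$. Create a root $n^0$ with $s(n^0)=s^0$ (the initial state) and $\mathit{sleep}(n^0)=\emptyset$, and call $\mathit{TreeExplore}(n^0)$, where $\mathit{TreeExplore}(n)$ does: set $Sl:=\mathit{sleep}(n)$; while $\mathit{enabled}(s(n))\setminus Sl\neq\emptyset$: choose the smallest $e\in\mathit{enabled}(s(n))\setminus Sl$, let $s'$ be such that $s(n)\xrightarrow{e}s'$; if $\mathit{IFS}(s',\mathit{enabled}(s')\setminus(Sl\setminus De))$ holds, then create a new node $n'$ with $s(n')=s'$ and $\mathit{sleep}(n')=Sl\setminus De$, add an edge $n\xrightarrow{e}n'$, and call $\mathit{TreeExplore}(n')$; in either case then set $Sl:=Sl\cup\{e\}$. The resulting tree (a transition system with initial state $n^0$) satisfies: (i) every full run of the tree is a full lex-run of $\mathrm{TS}(\mathcal{P})$; and (ii) for every full run $u$ of $\mathrm{TS}(\mathcal{P})$ there is a unique full run $v$ of the tree with $v\sim u$.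
   Context: A transition system has states, actions, an initial state and labelled transitions, action deterministic. A terminal state has no outgoing transitions; a run is a path (not necessarily from the initial state); a maximal run ends in a terminal state; a full run is a maximal run from the initial state. A client/server system $\mathcal{P}$: a finite set of processes $\mathit{Proc}=\mathit{Clients}\cup\mathit{Servers}$ (disjoint), each $p$ with a finite action-deterministic transition system $\mathrm{TS}_p$ over actions $\Sigma_p$, clients' systems acyclic; $\mathit{dom}(a)=\{p:a\in\Sigma_p\}$ consists of exactly one client and one server. $\mathrm{TS}(\mathcal{P})$: global states are tuples $(s_p)_p$, initial state the tuple of initial states, $s\xrightarrow{a}s'$ iff $s_p\xrightarrow{a}s'_p$ for $p\in\mathit{dom}(a)$ and $s'_p=s_p$ otherwise. $\mathit{enabled}(s)$ is the set of labels of transitions leaving global state $s$. Actions $a,b$ are independent if $\mathit{dom}(a)\cap\mathit{dom}(b)=\emptyset$, dependent otherwise; $De$ is the set of actions dependent on $e$. $u\sim w$ (trace equivalence) if $w$ is obtained from $u$ by repeatedly swapping adjacent independent actions. $\mathit{first}(u)=\{b:\exists v.\ bv\sim u\}$. $\mathit{IFS}(s,B)$ holds iff there is a maximal run $u$ from $s$ with $\mathit{first}(u)\subseteq B$. The linear order on actions induces the lexicographic order on sequences; a lex-sequence is a sequence that is lexicographically smallest in its $\sim$-class, and a lex-run is a lex-sequence that is a run of $\mathrm{TS}(\mathcal{P})$. -}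

module Defs where

open import Data.Nat using (ℕ)
open import Data.Fin using (Fin; _<_; _≤_; _≟_)
open import Data.Fin.Subset using (Subset; _∈_; _∪_; _─_; ⁅_⁆; ⊥)
open import Data.Vec using (tabulate)
open import Data.Bool using (Bool; _∨_)
open import Data.Maybe using (Maybe; just; nothing; is-just)
open import Data.List using (List; []; _∷_; _++_)
open import Data.Product using (Σ; ∃; ∃-syntax; _×_; _,_)
open import Data.Sum using (_⊎_)
open import Data.Empty using () renaming (⊥ to Empty)
open import Relation.Nullary using (¬_; yes; no)
open import Relation.Nullary.Decidable using (⌊_⌋)
open import Relation.Binary.PropositionalEquality using (_≡_; _≢_; refl)
open import Relation.Binary.Construct.Closure.ReflexiveTransitive using (Star)

-- Clients are Fin nC, servers Fin nS (disjoint by construction).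
-- Actions are Fin nA; the fixed linear order on actions is the order of Fin.
-- Each action a has dom(a) = {client a, server a}; so Σ_c = {a | client a ≡ c},
-- Σ_s = {a | server a ≡ s}.
-- Process p has states Fin (…St p), an initial state, and an
-- action-deterministic transition relation given as a partial function
-- whose transitions only carry actions of Σ_p.

record CSSystem : Set where
  field
    nC nS nA : ℕ
    client   : Fin nA → Fin nC
    server   : Fin nA → Fin nS
    CSt      : Fin nC → ℕ
    SSt      : Fin nS → ℕ
    cInit    : (c : Fin nC) → Fin (CSt c)
    sInit    : (s : Fin nS) → Fin (SSt s)
    cδ       : (c : Fin nC) → Fin (CSt c) → Fin nA → Maybe (Fin (CSt c))
    sδ       : (s : Fin nS) → Fin (SSt s) → Fin nA → Maybe (Fin (SSt s))
    cδ-dom   : ∀ c q a q' → cδ c q a ≡ just q' → client a ≡ c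
    sδ-dom   : ∀ s q a q' → sδ s q a ≡ just q' → server a ≡ s

  data CRun (c : Fin nC) : Fin (CSt c) → List (Fin nA) → Fin (CSt c) → Set where
    []  : ∀ {q} → CRun c q [] q
    _∷_ : ∀ {q a q' w q''} → cδ c q a ≡ just q' → CRun c q' w q'' → CRun c q (a ∷ w) q''

  Acyclic : Set
  Acyclic = ∀ c q a w → ¬ CRun c q (a ∷ w) q

record ClientServer : Set where
  field
    sys     : CSSystem
    acyclic : CSSystem.Acyclic sys
  open CSSystem sys public

module Sem (P : ClientServer) where
  open ClientServer P

  Action : Set
  Action = Fin nA

  record GState : Set where
    constructor gst
    field
      cs : (c : Fin nC) → Fin (CSt c)
      ss : (s : Fin nS) → Fin (SSt s)
  open GState

  updC : ((c : Fin nC) → Fin (CSt c)) → (c : Fin nC) → Fin (CSt c) → (c : Fin nC) → Fin (CSt c)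
  updC f c q c' with c ≟ c'
  ... | yes refl = q
  ... | no _ = f c'

  updS : ((s : Fin nS) → Fin (SSt s)) → (s : Fin nS) → Fin (SSt s) → (s : Fin nS) → Fin (SSt s)
  updS f s q s' with s ≟ s'
  ... | yes refl = q
  ... | no _ = f s'

  step : GState → Action → Maybe GState
  step g a with cδ (client a) (cs g (client a)) a | sδ (server a) (ss g (server a)) a
  ... | just q | just r = just (gst (updC (cs g) (client a) q) (updS (ss g) (server a) r))
  ... | _      | _      = nothing

  initial : GState
  initial = gst cInit sInit

  enabled : GState → Subset nA
  enabled g = tabulate (λ a → is-just (step g a))

  Terminal : GState → Set
  Terminal g = ∀ a → step g a ≡ nothing

  data Run : GState → List Action → GState → Set where
    []  : ∀ {g} → Run g [] g
    _∷_ : ∀ {g a g' w g''} → step g a ≡ just g' → Run g' w g'' → Run g (a ∷ w) g''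

  MaximalRunFrom : GState → List Action → Set
  MaximalRunFrom g u = ∃[ t ] (Run g u t × Terminal t)

  FullRun : List Action → Set
  FullRun u = MaximalRunFrom initial u

  Dependent : Action → Action → Set
  Dependent a b = client a ≡ client b ⊎ server a ≡ server b

  Independent : Action → Action → Set
  Independent a b = client a ≢ client b × server a ≢ server b

  D : Action → Subset nA
  D e = tabulate (λ a → ⌊ client a ≟ client e ⌋ ∨ ⌊ server a ≟ server e ⌋)

  data Swap : List Action → List Action → Set where
    swap : ∀ u a b v → Independent a b → Swap (u ++ a ∷ b ∷ v) (u ++ b ∷ a ∷ v)

  _∼_ : List Action → List Action → Set
  _∼_ = Star Swap

  first⊆ : List Action → Subset nA → Set
  first⊆ u B = ∀ b v → (b ∷ v) ∼ u → b ∈ B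

  IFS : GState → Subset nA → Set
  IFS g B = ∃[ u ] (MaximalRunFrom g u × first⊆ u B)

  data _<lex_ : List Action → List Action → Set where
    []<∷  : ∀ {b w} → [] <lex (b ∷ w)
    head< : ∀ {a b u w} → a < b → (a ∷ u) <lex (b ∷ w)
    tail< : ∀ {a u w} → u <lex w → (a ∷ u) <lex (a ∷ w)

  _≤lex_ : List Action → List Action → Set
  u ≤lex w = u ≡ w ⊎ u <lex w

  LexSeq : List Action → Set
  LexSeq u = ∀ w → w ∼ u → u ≤lex w

  FullLexRun : List Action → Set
  FullLexRun u = FullRun u × LexSeq u

  -- The tree built by TreeExplore.
  -- A node is determined (for what TreeExplore does with it) by
  -- its state and sleep set; the tree is the unfolding from the root.

  Node : Set
  Node = GState × Subset nA

  root : Node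
  root = initial , ⊥

  -- Loop s Sl e Sl' : the while loop of TreeExplore at state s started with
  -- Sl := Sl, reaches an iteration in which it chooses e while the current
  -- value of the variable Sl is Sl'.
  data Loop (s : GState) : Subset nA → Action → Subset nA → Set where
    chosen : ∀ {Sl e} → e ∈ (enabled s ─ Sl) →
             (∀ e' → e' ∈ (enabled s ─ Sl) → e ≤ e') →
             Loop s Sl e Sl
    later  : ∀ {Sl e₀ e Sl'} → e₀ ∈ (enabled s ─ Sl) →
             (∀ e' → e' ∈ (enabled s ─ Sl) → e₀ ≤ e') →
             Loop s (Sl ∪ ⁅ e₀ ⁆) e Sl' →
             Loop s Sl e Sl'

  data Edge : Node → Action → Node → Set where
    edge : ∀ {s Sl₀ e Sl s'} → Loop s Sl₀ e Sl → step s e ≡ just s' →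
           IFS s' (enabled s' ─ (Sl ─ D e)) →
           Edge (s , Sl₀) e (s' , (Sl ─ D e))

  data TreeRun : Node → List Action → Node → Set where
    []  : ∀ {n} → TreeRun n [] n
    _∷_ : ∀ {n a n' w n''} → Edge n a n' → TreeRun n' w n'' → TreeRun n (a ∷ w) n''

  TreeTerminal : Node → Set
  TreeTerminal n = ∀ e n' → ¬ Edge n e n'

  TreeFullRun : List Action → Set
  TreeFullRun v = ∃[ n ] (TreeRun root v n × TreeTerminal n)

{-# OPTIONS --safe #-}
-- Call a maximal run u from s(n) whose first actions are all awake (first(u) ∩ sleep(n) = ∅)
-- a witness for the IFS test at node n. Given a witness, the while loop at n reaches the least
-- e ∈ first(u): before that it only puts to sleep actions below e. Commuting e to the front of
-- u leaves a witness for the child along e: an action of first(rest) asleep there is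
-- independent of e, hence in first(u), yet asleep at n or below e. Induction on |u| gives a
-- tree path equivalent to u, and also shows that a leaf, whose IFS test succeeded, is a
-- terminal state. Conversely, nothing in first(v) is asleep along a tree path v, and an action
-- b < e skipped before an e-edge stays asleep below it unless it depends on e, so no smaller
-- action can be commuted in front of e and v is a lex-sequence. A trace class has only one
-- lexicographic minimum, which gives uniqueness. The root has a witness because acyclic
-- clients bound every run by the sum of their state counts.
module Submission where

open import Defs
open import Data.Bool using (Bool; true; _∨_)
open import Data.Fin as F using (Fin; zero; suc; _≟_; punchIn)
open import Data.Fin.Properties using (≤-refl; ≤∧≢⇒<; punchInᵢ≢i; any?)
open import Data.Fin.Subset using (Subset; _∈_; _∉_; _∪_; _─_; _-_; ⁅_⁆; _⊆_; _⊂_; ∣_∣; ⊤; inside; outside)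
open import Data.Fin.Subset.Induction using (⊂-wellFounded)
open import Data.Fin.Subset.Properties
  using (∈⊤; ∉⊥; ∣⊤∣≡n; x∈p⇒∣p-x∣<∣p∣; x∈p⇒p-x⊂p; x∈p∧x≢y⇒x∈p-y; x∈p∧x∉q⇒x∈p─q; p─q⊆p;
         p─q─r≡p─q∪r; x∈p∪q⁺; x∈p∪q⁻; x∈⁅x⁆; x∈⁅y⁆⇒x≡y; _∈?_)
open import Data.List using (List; []; _∷_; length; filter)
open import Data.List.Properties using (filter-accept; filter-reject)
open import Data.Maybe using (just; nothing; is-just)
open import Data.Nat as ℕ using (ℕ; zero; suc; z≤n; s≤s; _+_)
open import Data.Nat.Properties as ℕₚ using (≤-trans; <⇒≤; <⇒≱; ≮⇒≥; ≤-pred; suc-injective; +-mono-≤; n≮0)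
open import Algebra.Properties.CommutativeMonoid.Sum ℕₚ.+-0-commutativeMonoid
  using (sum; sum-remove; sum-cong-≗; sum-replicate-zero)
open import Data.Product using (∃; ∃₂; ∃-syntax; _×_; _,_; proj₁; proj₂; map₂)
open import Data.Sum using (_⊎_; inj₁; inj₂; [_,_])
open import Data.Vec using (tabulate; _∷_; there)
open import Data.Vec.Properties using ([]=⇒lookup; lookup⇒[]=; lookup∘tabulate)
open import Function using (_∘_; id)
open import Induction.WellFounded using (Acc; acc)
open import Relation.Binary.Construct.Closure.ReflexiveTransitive using (ε; _◅_; _◅◅_)
open import Relation.Binary.PropositionalEquality
  using (_≡_; _≢_; refl; sym; trans; cong; cong₂; subst; module ≡-Reasoning)
open import Relation.Nullary using (¬_; Dec; yes; no; contradiction)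
open import Relation.Nullary.Decidable using (map′; _×-dec_; ¬?; ⌊_⌋)
open import Relation.Unary using (Pred; Decidable)

least : ∀ {n p} {P : Pred (Fin n) p} → Decidable P → ∀ {x} → P x →
        ∃[ m ] (P m × (∀ {y} → P y → m F.≤ y))
least {suc n} P? {x} px with P? zero
... | yes p₀ = zero , p₀ , λ _ → z≤n
least {suc n} P? {zero}  px | no ¬p₀ = contradiction px ¬p₀
least {suc n} P? {suc x} px | no ¬p₀ with least (P? ∘ suc) px
... | m , pm , m-min = suc m , pm , λ { {zero} p → contradiction p ¬p₀ ; {suc y} p → s≤s (m-min p) }

x∈p─q⇒x∉q : ∀ {n} {x : Fin n} {p q : Subset n} → x ∈ p ─ q → x ∉ q
x∈p─q⇒x∉q {p = _ ∷ p} {inside  ∷ q} (there x∈p─q) (there x∈q) = x∈p─q⇒x∉q x∈p─q x∈q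
x∈p─q⇒x∉q {p = _ ∷ p} {outside ∷ q} (there x∈p─q) (there x∈q) = x∈p─q⇒x∉q x∈p─q x∈q

isYes-∨ : ∀ {a b} {A : Set a} {B : Set b} (a? : Dec A) (b? : Dec B) → A ⊎ B → ⌊ a? ⌋ ∨ ⌊ b? ⌋ ≡ true
isYes-∨ (yes _)  _        _        = refl
isYes-∨ (no _)   (yes _)  _        = refl
isYes-∨ (no ¬a)  (no _)   (inj₁ a) = contradiction a ¬a
isYes-∨ (no _)   (no ¬b)  (inj₂ b) = contradiction b ¬b

∈-tabulate⁺ : ∀ {n} {f : Fin n → Bool} {x} → f x ≡ true → x ∈ tabulate f
∈-tabulate⁺ {f = f} {x} fx = lookup⇒[]= x _ (trans (lookup∘tabulate f x) fx)

∈-tabulate⁻ : ∀ {n} {f : Fin n → Bool} {x} → x ∈ tabulate f → f x ≡ true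
∈-tabulate⁻ {f = f} {x} x∈ = trans (sym (lookup∘tabulate f x)) ([]=⇒lookup x∈)

∑-mono-≤ : ∀ {n} {f g : Fin n → ℕ} → (∀ i → f i ℕ.≤ g i) → sum f ℕ.≤ sum g
∑-mono-≤ {zero}  _   = z≤n
∑-mono-≤ {suc n} f≤g = +-mono-≤ (f≤g zero) (∑-mono-≤ (f≤g ∘ suc))

count : ∀ {A : Set} {n} → (A → Fin n) → Fin n → List A → ℕ
count f i u = length (filter (λ x → f x ≟ i) u)

length≡∑count : ∀ {A : Set} {n} (f : A → Fin n) u → length u ≡ sum (λ i → count f i u)
length≡∑count {n = n} f [] = sym (sum-replicate-zero n)
length≡∑count {n = zero}  f (x ∷ u) with () ← f x
length≡∑count {n = suc n} f (x ∷ u) = begin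
  suc (length u)                                        ≡⟨ cong suc (length≡∑count f u) ⟩
  suc (sum (counts u))                                  ≡⟨ cong suc (sum-remove {i = f x} (counts u)) ⟩
  suc (counts u (f x) + sum (counts u ∘ punchIn (f x))) ≡⟨ cong₂ _+_ (sym hit) (sum-cong-≗ (sym ∘ miss)) ⟩
  counts (x ∷ u) (f x) + sum (counts (x ∷ u) ∘ punchIn (f x))
                                                        ≡⟨ sym (sum-remove (counts (x ∷ u))) ⟩
  sum (counts (x ∷ u))                                  ∎
  where
  open ≡-Reasoning
  counts : List _ → Fin (suc n) → ℕ
  counts v i = count f i v
  hit : counts (x ∷ u) (f x) ≡ suc (counts u (f x))
  hit = cong length (filter-accept (λ y → f y ≟ f x) refl)
  miss : ∀ j → counts (x ∷ u) (punchIn (f x) j) ≡ counts u (punchIn (f x) j)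
  miss j = cong length (filter-reject (λ y → f y ≟ punchIn (f x) j) (punchInᵢ≢i (f x) j ∘ sym))

module FunctionUpdate {n} {B : Fin n → Set}
  (update : ((i : Fin n) → B i) → (i : Fin n) → B i → (j : Fin n) → B j)
  (update-same : ∀ f i x → update f i x i ≡ x)
  (update-other : ∀ f i x j → i ≢ j → update f i x j ≡ f j)
  where

  update-cong : ∀ {f g} → (∀ j → f j ≡ g j) → ∀ i x j → update f i x j ≡ update g i x j
  update-cong {f} {g} f≗g i x j with i ≟ j
  ... | yes refl = trans (update-same f i x) (sym (update-same g i x))
  ... | no i≢j   = trans (update-other f i x j i≢j) (trans (f≗g j) (sym (update-other g i x j i≢j)))

  update-comm : ∀ f {i i'} x x' → i ≢ i' → ∀ j →
                update (update f i x) i' x' j ≡ update (update f i' x') i x j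
  update-comm f {i} {i'} x x' i≢i' j with i ≟ j | i' ≟ j
  ... | yes refl | yes refl = contradiction refl i≢i'
  ... | yes refl | no i'≢i  = begin
    update (update f i x) i' x' i ≡⟨ update-other _ i' x' i i'≢i ⟩
    update f i x i                ≡⟨ update-same f i x ⟩
    x                             ≡⟨ update-same _ i x ⟨
    update (update f i' x') i x i ∎
    where open ≡-Reasoning
  ... | no _     | yes refl = begin
    update (update f i x) i' x' i' ≡⟨ update-same _ i' x' ⟩
    x'                             ≡⟨ update-same f i' x' ⟨
    update f i' x' i'              ≡⟨ update-other _ i x i' i≢i' ⟨
    update (update f i' x') i x i' ∎
    where open ≡-Reasoning
  ... | no i≢j | no i'≢j = begin
    update (update f i x) i' x' j ≡⟨ update-other _ i' x' j i'≢j ⟩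
    update f i x j                ≡⟨ update-other f i x j i≢j ⟩
    f j                           ≡⟨ update-other f i' x' j i'≢j ⟨
    update f i' x' j              ≡⟨ update-other _ i x j i≢j ⟨
    update (update f i' x') i x j ∎
    where open ≡-Reasoning

module _ (S : CSSystem) (acyclic : CSSystem.Acyclic S) where
  open CSSystem S

  client-run-length< : ∀ {c q w q'} → CRun c q w q' → length w ℕ.< CSt c
  client-run-length< {c} {w = w} run = subst (length w ℕ.<_) (∣⊤∣≡n (CSt c)) (bounded run ⊤ (λ _ → ∈⊤))
    where
    -- A client never revisits a state, so each step leaves one more state of X behind.
    bounded : ∀ {q w q'} → CRun c q w q' → (X : Subset (CSt c)) →
              (∀ {x} → ∃[ v ] CRun c q v x → x ∈ X) → length w ℕ.< ∣ X ∣
    bounded [] X reach⊆X = ℕₚ.≤-<-trans z≤n (x∈p⇒∣p-x∣<∣p∣ (reach⊆X ([] , [])))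
    bounded {q} (_∷_ {a = a} st run) X reach⊆X =
      ≤-trans (s≤s (bounded run (X - q) reach⊆X-q)) (x∈p⇒∣p-x∣<∣p∣ (reach⊆X ([] , [])))
      where
      reach⊆X-q : ∀ {x} → ∃[ v ] CRun c _ v x → x ∈ X - q
      reach⊆X-q (v , run') = x∈p∧x≢y⇒x∈p-y (reach⊆X (a ∷ v , st ∷ run'))
        λ { refl → acyclic c q a v (st ∷ run') }

module Exploration (P : ClientServer) where
  open ClientServer P
  open Sem P
  open GState

  independent-sym : ∀ {a b} → Independent a b → Independent b a
  independent-sym (c≢ , s≢) = c≢ ∘ sym , s≢ ∘ sym

  independent-irrefl : ∀ {a} → ¬ Independent a a
  independent-irrefl (c≢ , _) = c≢ refl

  independent? : ∀ a b → Dec (Independent a b)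
  independent? a b = ¬? (client a ≟ client b) ×-dec ¬? (server a ≟ server b)

  independent⇒∉D : ∀ {b e} → Independent b e → b ∉ D e
  independent⇒∉D {b} {e} (c≢ , s≢) b∈De with client b ≟ client e | server b ≟ server e | ∈-tabulate⁻ b∈De
  ... | yes c≡ | _      | _  = c≢ c≡
  ... | no _   | yes s≡ | _  = s≢ s≡
  ... | no _   | no _   | ()

  dependent⇒∈D : ∀ {b e} → Dependent b e → b ∈ D e
  dependent⇒∈D {b} {e} = ∈-tabulate⁺ ∘ isYes-∨ (client b ≟ client e) (server b ≟ server e)

  ∉D⇒independent : ∀ {b e} → b ∉ D e → Independent b e
  ∉D⇒independent b∉De = b∉De ∘ dependent⇒∈D ∘ inj₁ , b∉De ∘ dependent⇒∈D ∘ inj₂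

  updC-same : ∀ f c q → updC f c q c ≡ q
  updC-same f c q with c ≟ c
  ... | yes refl = refl
  ... | no c≢c   = contradiction refl c≢c

  updC-other : ∀ f c q c' → c ≢ c' → updC f c q c' ≡ f c'
  updC-other f c q c' c≢c' with c ≟ c'
  ... | yes c≡c' = contradiction c≡c' c≢c'
  ... | no _     = refl

  updS-same : ∀ f s r → updS f s r s ≡ r
  updS-same f s r with s ≟ s
  ... | yes refl = refl
  ... | no s≢s   = contradiction refl s≢s

  updS-other : ∀ f s r s' → s ≢ s' → updS f s r s' ≡ f s'
  updS-other f s r s' s≢s' with s ≟ s'
  ... | yes s≡s' = contradiction s≡s' s≢s'
  ... | no _     = refl

  module C = FunctionUpdate updC updC-same updC-other
  module S = FunctionUpdate updS updS-same updS-other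

  -- States are functions, so without function extensionality they are only equal pointwise.
  infix 4 _≈_
  _≈_ : GState → GState → Set
  g ≈ h = (∀ c → cs g c ≡ cs h c) × (∀ s → ss g s ≡ ss h s)

  ≈-refl : ∀ {g} → g ≈ g
  ≈-refl = (λ _ → refl) , (λ _ → refl)

  ≈-sym : ∀ {g h} → g ≈ h → h ≈ g
  ≈-sym (c≗ , s≗) = sym ∘ c≗ , sym ∘ s≗

  ≈-trans : ∀ {g h k} → g ≈ h → h ≈ k → g ≈ k
  ≈-trans (c≗ , s≗) (c≗' , s≗') = (λ c → trans (c≗ c) (c≗' c)) , (λ s → trans (s≗ s) (s≗' s))

  record Synchronised (g : GState) (a : Action) (h : GState) : Set where
    constructor synchronised
    field
      {q}         : Fin (CSt (client a))
      {r}         : Fin (SSt (server a))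
      client-step : cδ (client a) (cs g (client a)) a ≡ just q
      server-step : sδ (server a) (ss g (server a)) a ≡ just r
      result      : h ≡ gst (updC (cs g) (client a) q) (updS (ss g) (server a) r)

  step⇒synchronised : ∀ {g a h} → step g a ≡ just h → Synchronised g a h
  step⇒synchronised {g} {a} st
    with cδ (client a) (cs g (client a)) a in c-step | sδ (server a) (ss g (server a)) a in s-step
  step⇒synchronised refl | just _ | just _ = synchronised c-step s-step refl

  synchronised⇒step : ∀ {g a q r} →
    cδ (client a) (cs g (client a)) a ≡ just q → sδ (server a) (ss g (server a)) a ≡ just r →
    step g a ≡ just (gst (updC (cs g) (client a) q) (updS (ss g) (server a) r))
  synchronised⇒step c-step s-step rewrite c-step | s-step = refl

  step-resp : ∀ {g g' a h} → g ≈ g' → step g a ≡ just h → ∃[ h' ] (step g' a ≡ just h' × h ≈ h')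
  step-resp {a = a} (c≗ , s≗) st with step⇒synchronised st
  ... | synchronised {q} {r} c-step s-step refl =
    _ , synchronised⇒step (subst (λ x → cδ (client a) x a ≡ just q) (c≗ (client a)) c-step)
                          (subst (λ x → sδ (server a) x a ≡ just r) (s≗ (server a)) s-step) ,
    C.update-cong c≗ (client a) q , S.update-cong s≗ (server a) r

  diamond : ∀ {s s₁ s₂ e a} → Independent e a → step s a ≡ just s₁ → step s₁ e ≡ just s₂ →
            ∃₂ λ s₃ s₄ → step s e ≡ just s₃ × step s₃ a ≡ just s₄ × s₄ ≈ s₂
  diamond {s} {e = e} {a} (c≢ , s≢) st₁ st₂ with step⇒synchronised st₁
  ... | synchronised {q} {r} c-step s-step refl with step⇒synchronised st₂
  ... | synchronised {q'} {r'} c-step' s-step' refl =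
    _ , _ , synchronised⇒step e-client e-server , synchronised⇒step a-client a-server ,
    C.update-comm (cs s) q' q c≢ , S.update-comm (ss s) r' r s≢
    where
    e-client : cδ (client e) (cs s (client e)) e ≡ just q'
    e-client = subst (λ x → cδ (client e) x e ≡ just q')
                     (updC-other (cs s) (client a) q (client e) (c≢ ∘ sym)) c-step'
    e-server : sδ (server e) (ss s (server e)) e ≡ just r'
    e-server = subst (λ x → sδ (server e) x e ≡ just r')
                     (updS-other (ss s) (server a) r (server e) (s≢ ∘ sym)) s-step'
    a-client : cδ (client a) (updC (cs s) (client e) q' (client a)) a ≡ just q
    a-client = subst (λ x → cδ (client a) x a ≡ just q)
                     (sym (updC-other (cs s) (client e) q' (client a) c≢)) c-step
    a-server : sδ (server a) (updS (ss s) (server e) r' (server a)) a ≡ just r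
    a-server = subst (λ x → sδ (server a) x a ≡ just r)
                     (sym (updS-other (ss s) (server e) r' (server a) s≢)) s-step

  run-resp : ∀ {g g' w t} → g ≈ g' → Run g w t → ∃[ t' ] (Run g' w t' × t ≈ t')
  run-resp g≈g' [] = _ , [] , g≈g'
  run-resp g≈g' (st ∷ run) with step-resp g≈g' st
  ... | _ , st' , h≈h' with run-resp h≈h' run
  ... | _ , run' , t≈t' = _ , st' ∷ run' , t≈t'

  terminal-resp : ∀ {t t'} → t ≈ t' → Terminal t → Terminal t'
  terminal-resp {t' = t'} t≈t' T a with step t' a in st
  ... | nothing = refl
  ... | just _ with step-resp (≈-sym t≈t') st
  ... | _ , st' , _ = contradiction (trans (sym st') (T a)) λ ()

  step⇒enabled : ∀ {s b s'} → step s b ≡ just s' → b ∈ enabled s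
  step⇒enabled st = ∈-tabulate⁺ (cong is-just st)

  -- Trace equivalence

  data Transposition : List Action → List Action → Set where
    here  : ∀ {a b v} → Independent a b → Transposition (a ∷ b ∷ v) (b ∷ a ∷ v)
    there : ∀ {x u w} → Transposition u w → Transposition (x ∷ u) (x ∷ w)

  swap⇒transposition : ∀ {u w} → Swap u w → Transposition u w
  swap⇒transposition (swap []      a b v i) = here i
  swap⇒transposition (swap (x ∷ p) a b v i) = there (swap⇒transposition (swap p a b v i))

  transposition⇒∼ : ∀ {u w} → Transposition u w → u ∼ w
  transposition⇒∼ t = swap′ t ◅ ε
    where
    swap′ : ∀ {u w} → Transposition u w → Swap u w
    swap′ (here {a} {b} {v} i) = swap [] a b v i
    swap′ {x ∷ _} (there t) with swap′ t
    ... | swap p a b v i = swap (x ∷ p) a b v i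

  transposition-sym : ∀ {u w} → Transposition u w → Transposition w u
  transposition-sym (here i)  = here (independent-sym i)
  transposition-sym (there t) = there (transposition-sym t)

  transposition-length : ∀ {u w} → Transposition u w → length u ≡ length w
  transposition-length (here _)  = refl
  transposition-length (there t) = cong suc (transposition-length t)

  ∼-sym : ∀ {u w} → u ∼ w → w ∼ u
  ∼-sym ε          = ε
  ∼-sym (s ◅ u∼w) = ∼-sym u∼w ◅◅ transposition⇒∼ (transposition-sym (swap⇒transposition s))

  ∼-cons : ∀ {x u w} → u ∼ w → (x ∷ u) ∼ (x ∷ w)
  ∼-cons ε          = ε
  ∼-cons (s ◅ u∼w) = transposition⇒∼ (there (swap⇒transposition s)) ◅◅ ∼-cons u∼w

  ∼-length : ∀ {u w} → u ∼ w → length u ≡ length w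
  ∼-length ε          = refl
  ∼-length (s ◅ u∼w) = trans (transposition-length (swap⇒transposition s)) (∼-length u∼w)

  data Pull (b : Action) : List Action → List Action → Set where
    here : ∀ {u} → Pull b (b ∷ u) u
    skip : ∀ {a u r} → Independent b a → Pull b u r → Pull b (a ∷ u) (a ∷ r)

  pull-∼ : ∀ {b u r} → Pull b u r → (b ∷ r) ∼ u
  pull-∼ here       = ε
  pull-∼ (skip i p) = transposition⇒∼ (here i) ◅◅ ∼-cons (pull-∼ p)

  pull-head : ∀ {a w r} → Pull a (a ∷ w) r → r ≡ w
  pull-head here       = refl
  pull-head (skip i _) = contradiction i independent-irrefl

  pull-transposition : ∀ {b u w r} → Pull b u r → Transposition u w → ∃[ r' ] (Pull b w r' × r ∼ r')
  pull-transposition here                (here i)  = _ , skip i here , ε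
  pull-transposition (skip _ here)       (here _)  = _ , here , ε
  pull-transposition (skip i (skip j p)) (here k)  = _ , skip j (skip i p) , transposition⇒∼ (here k)
  pull-transposition here                (there t) = _ , here , transposition⇒∼ t
  pull-transposition (skip i p)          (there t) with pull-transposition p t
  ... | _ , p' , r∼r' = _ , skip i p' , ∼-cons r∼r'

  pull-resp-∼ : ∀ {b u w r} → Pull b u r → u ∼ w → ∃[ r' ] (Pull b w r' × r ∼ r')
  pull-resp-∼ p ε = _ , p , ε
  pull-resp-∼ p (s ◅ u∼w) with pull-transposition p (swap⇒transposition s)
  ... | _ , p' , r∼r' with pull-resp-∼ p' u∼w
  ... | _ , p'' , r'∼r'' = _ , p'' , r∼r' ◅◅ r'∼r''

  ∼-cancel : ∀ {a u w} → (a ∷ u) ∼ (a ∷ w) → u ∼ w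
  ∼-cancel au∼aw with pull-resp-∼ here au∼aw
  ... | _ , p , u∼r rewrite pull-head p = u∼r

  -- The paper's b ∈ first(u); pull-∼ and ∼⇒first give the two directions.
  First : Action → List Action → Set
  First b u = ∃ (Pull b u)

  ∼⇒first : ∀ {b v u} → (b ∷ v) ∼ u → First b u
  ∼⇒first bv∼u = map₂ proj₁ (pull-resp-∼ here bv∼u)

  first-skip : ∀ {b e u r} → Independent b e → First b r → Pull e u r → First b u
  first-skip i (_ , p) pull = ∼⇒first (transposition⇒∼ (here i) ◅◅ ∼-cons (pull-∼ p) ◅◅ pull-∼ pull)

  first? : ∀ b u → Dec (First b u)
  first? b []      = no λ { (_ , ()) }
  first? b (a ∷ u) with a ≟ b
  ... | yes refl = yes (u , here)
  ... | no a≢b   = map′ (λ { (i , _ , p) → _ , skip i p })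
                        (λ { (_ , here) → contradiction refl a≢b ; (_ , skip i p) → i , _ , p })
                        (independent? b a ×-dec first? b u)

  run-pull : ∀ {e u r s t} → Pull e u r → Run s u t →
             ∃₂ λ s' t' → step s e ≡ just s' × Run s' r t' × t ≈ t'
  run-pull here (st ∷ run) = _ , _ , st , run , ≈-refl
  run-pull (skip i p) (st ∷ run) with run-pull p run
  ... | _ , _ , st' , run' , t≈t' with diamond i st st'
  ... | _ , _ , st₃ , st₄ , s₄≈s₂ with run-resp (≈-sym s₄≈s₂) run'
  ... | _ , run'' , t'≈t'' = _ , _ , st₃ , st₄ ∷ run'' , ≈-trans t≈t' t'≈t''

  maximal-run-pull : ∀ {e u r s} → Pull e u r → MaximalRunFrom s u →
                     ∃[ s' ] (step s e ≡ just s' × MaximalRunFrom s' r)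
  maximal-run-pull p (_ , run , T) with run-pull p run
  ... | s' , t' , st , run' , t≈t' = s' , st , t' , run' , terminal-resp t≈t' T

  first-enabled : ∀ {b u s t} → First b u → Run s u t → b ∈ enabled s
  first-enabled (_ , p) run with run-pull p run
  ... | _ , _ , st , _ = step⇒enabled st

  -- Existence of maximal runs

  run⇒client-run : ∀ c {g u g'} → Run g u g' →
                   CRun c (cs g c) (filter (λ a → client a ≟ c) u) (cs g' c)
  run⇒client-run c [] = []
  run⇒client-run c {g} (_∷_ {a = a} st run) with step⇒synchronised st
  ... | synchronised {q} c-step _ refl with client a ≟ c
  ... | yes refl = c-step ∷ subst (λ x → CRun (client a) x _ _) (updC-same (cs g) (client a) q)
                                  (run⇒client-run (client a) run)
  ... | no ca≢c  = subst (λ x → CRun c x _ _) (updC-other (cs g) (client a) q c ca≢c) (run⇒client-run c run)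

  run-length≤ : ∀ {g u g'} → Run g u g' → length u ℕ.≤ sum CSt
  run-length≤ {u = u} run = begin
    length u                     ≡⟨ length≡∑count client u ⟩
    sum (λ c → count client c u) ≤⟨ ∑-mono-≤ (λ c → <⇒≤ (client-bound c)) ⟩
    sum CSt                      ∎
    where
    open ℕₚ.≤-Reasoning
    client-bound : ∀ c → count client c u ℕ.< CSt c
    client-bound c = client-run-length< sys acyclic (run⇒client-run c run)

  step? : ∀ g a → Dec (∃[ h ] step g a ≡ just h)
  step? g a with step g a
  ... | just h  = yes (h , refl)
  ... | nothing = no λ { (_ , ()) }

  stuck⇒terminal : ∀ {g} → ¬ (∃₂ λ a h → step g a ≡ just h) → Terminal g
  stuck⇒terminal {g} stuck a with step g a in st
  ... | nothing = refl
  ... | just h  = contradiction (a , h , st) stuck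

  maximal-run-exists : ∀ g → ∃[ u ] MaximalRunFrom g u
  maximal-run-exists g = extend (suc (sum CSt)) g (s≤s ∘ run-length≤)
    where
    extend : ∀ k g → (∀ {u t} → Run g u t → length u ℕ.< k) → ∃[ u ] MaximalRunFrom g u
    extend zero    g bound = contradiction (bound []) n≮0
    extend (suc k) g bound with any? (step? g)
    ... | no stuck = [] , g , [] , stuck⇒terminal stuck
    ... | yes (a , h , st) with extend k h (≤-pred ∘ bound ∘ (st ∷_))
    ... | u , t , run , T = a ∷ u , t , st ∷ run , T

  -- Lex-sequences

  <lex-asym : ∀ {u w} → u <lex w → ¬ (w <lex u)
  <lex-asym (head< a<b) (head< b<a) = <⇒≱ a<b (<⇒≤ b<a)
  <lex-asym (head< a<a) (tail< _)   = <⇒≱ a<a ≤-refl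
  <lex-asym (tail< _)   (head< a<a) = <⇒≱ a<a ≤-refl
  <lex-asym (tail< u<w) (tail< w<u) = <lex-asym u<w w<u

  lexSeq-[] : LexSeq []
  lexSeq-[] []      _ = inj₁ refl
  lexSeq-[] (_ ∷ _) _ = inj₂ []<∷

  lexSeq-∷ : ∀ {e y} → (∀ {b v} → (b ∷ v) ∼ (e ∷ y) → e F.≤ b) → LexSeq y → LexSeq (e ∷ y)
  lexSeq-∷ e-least lex-y [] []∼ey = contradiction (∼-length []∼ey) λ ()
  lexSeq-∷ {e} e-least lex-y (b ∷ w) bw∼ey with e ≟ b
  ... | no e≢b   = inj₂ (head< (≤∧≢⇒< (e-least bw∼ey) e≢b))
  ... | yes refl with lex-y w (∼-cancel bw∼ey)
  ... | inj₁ y≡w = inj₁ (cong (e ∷_) y≡w)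
  ... | inj₂ y<w = inj₂ (tail< y<w)

  lexSeq-unique : ∀ {u w} → LexSeq u → LexSeq w → u ∼ w → u ≡ w
  lexSeq-unique lex-u lex-w u∼w with lex-u _ (∼-sym u∼w) | lex-w _ u∼w
  ... | inj₁ u≡w | _        = u≡w
  ... | inj₂ _   | inj₁ w≡u = sym w≡u
  ... | inj₂ u<w | inj₂ w<u = contradiction w<u (<lex-asym u<w)

  -- The while loop of TreeExplore

  loop-⊇ : ∀ {s Sl e Sl'} → Loop s Sl e Sl' → Sl ⊆ Sl'
  loop-⊇ (chosen _ _)     = id
  loop-⊇ (later _ _ loop) = loop-⊇ loop ∘ x∈p∪q⁺ ∘ inj₁

  loop-chosen : ∀ {s Sl e Sl'} → Loop s Sl e Sl' → e ∈ enabled s ─ Sl'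
  loop-chosen (chosen e∈ _)    = e∈
  loop-chosen (later _ _ loop) = loop-chosen loop

  loop-below : ∀ {s Sl e Sl' b} → Loop s Sl e Sl' → b ∈ enabled s → b F.< e → b ∈ Sl'
  loop-below {Sl = Sl} {b = b} (chosen _ e-min) b∈ b<e with b ∈? Sl
  ... | yes b∈Sl = b∈Sl
  ... | no b∉Sl  = contradiction (e-min b (x∈p∧x∉q⇒x∈p─q b∈ b∉Sl)) (<⇒≱ b<e)
  loop-below (later _ _ loop) = loop-below loop

  loop-later-< : ∀ {s Sl e₀ e Sl'} → (∀ e' → e' ∈ enabled s ─ Sl → e₀ F.≤ e') →
                 Loop s (Sl ∪ ⁅ e₀ ⁆) e Sl' → e₀ F.< e
  loop-later-< {Sl = Sl} {e₀} {e} {Sl'} e₀-min loop =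
    ≤∧≢⇒< (e₀-min _ (x∈p∧x∉q⇒x∈p─q (p─q⊆p _ _ e∈) (e∉ ∘ x∈p∪q⁺ ∘ inj₁)))
          (λ { refl → e∉ (x∈p∪q⁺ (inj₂ (x∈⁅x⁆ e₀))) })
    where
    e∈ : e ∈ enabled _ ─ Sl'
    e∈ = loop-chosen loop
    e∉ : e ∉ Sl ∪ ⁅ e₀ ⁆
    e∉ = x∈p─q⇒x∉q e∈ ∘ loop-⊇ loop

  loop-⊆ : ∀ {s Sl e Sl' b} → Loop s Sl e Sl' → b ∈ Sl' → b ∈ Sl ⊎ b F.< e
  loop-⊆ (chosen _ _) b∈Sl' = inj₁ b∈Sl'
  loop-⊆ {Sl = Sl} (later {e₀ = e₀} _ e₀-min loop) b∈Sl' with loop-⊆ loop b∈Sl'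
  ... | inj₂ b<e = inj₂ b<e
  ... | inj₁ b∈Sl∪e₀ with x∈p∪q⁻ Sl ⁅ e₀ ⁆ b∈Sl∪e₀
  ... | inj₁ b∈Sl = inj₁ b∈Sl
  ... | inj₂ b∈e₀ rewrite x∈⁅y⁆⇒x≡y e₀ b∈e₀ = inj₂ (loop-later-< e₀-min loop)

  loop-reaches : ∀ {s e} Sl → e ∈ enabled s ─ Sl → ∃[ Sl' ] Loop s Sl e Sl'
  loop-reaches {s} {e} Sl = go Sl (⊂-wellFounded _)
    where
    go : ∀ Sl → Acc _⊂_ (enabled s ─ Sl) → e ∈ enabled s ─ Sl → ∃[ Sl' ] Loop s Sl e Sl'
    go Sl (acc rec) e∈ with least (_∈? enabled s ─ Sl) e∈
    ... | e₀ , e₀∈ , e₀-min with e₀ ≟ e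
    ... | yes refl = Sl , chosen e₀∈ (λ _ → e₀-min)
    ... | no e₀≢e  = map₂ (later e₀∈ (λ _ → e₀-min)) (go (Sl ∪ ⁅ e₀ ⁆) (rec shrinks) e∈')
      where
      fewer : enabled s ─ Sl - e₀ ≡ enabled s ─ (Sl ∪ ⁅ e₀ ⁆)
      fewer = p─q─r≡p─q∪r (enabled s) Sl ⁅ e₀ ⁆
      shrinks : enabled s ─ (Sl ∪ ⁅ e₀ ⁆) ⊂ enabled s ─ Sl
      shrinks = subst (_⊂ enabled s ─ Sl) fewer (x∈p⇒p-x⊂p e₀∈)
      e∈' : e ∈ enabled s ─ (Sl ∪ ⁅ e₀ ⁆)
      e∈' = subst (e ∈_) fewer (x∈p∧x≢y⇒x∈p-y e∈ (e₀≢e ∘ sym))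

  -- The exploration tree

  FirstDisjoint : List Action → Subset nA → Set
  FirstDisjoint u Sl = ∀ {b} → First b u → b ∉ Sl

  IFSWitness : Node → List Action → Set
  IFSWitness n u = MaximalRunFrom (proj₁ n) u × FirstDisjoint u (proj₂ n)

  NodeIFS : Node → Set
  NodeIFS n = IFS (proj₁ n) (enabled (proj₁ n) ─ proj₂ n)

  witness⇒IFS : ∀ {n u} → IFSWitness n u → NodeIFS n
  witness⇒IFS {u = u} (mr@(_ , run , _) , disj) =
    u , mr , λ _ _ bv∼u → x∈p∧x∉q⇒x∈p─q (first-enabled (∼⇒first bv∼u) run) (disj (∼⇒first bv∼u))

  IFS⇒witness : ∀ {n} → NodeIFS n → ∃ (IFSWitness n)
  IFS⇒witness (u , mr , first⊆) = u , mr , λ (_ , p) → x∈p─q⇒x∉q (first⊆ _ _ (pull-∼ p))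

  root-IFS : NodeIFS root
  root-IFS = witness⇒IFS (proj₂ (maximal-run-exists initial) , λ _ → ∉⊥)

  child-disjoint : ∀ {s Sl e Sl' u r} → Loop s Sl e Sl' → Pull e u r → FirstDisjoint u Sl →
                   (∀ {b} → First b u → e F.≤ b) → FirstDisjoint r (Sl' ─ D e)
  child-disjoint loop pull disj e-least {b} fb b∈ =
    [ disj fb' , (λ b<e → <⇒≱ b<e (e-least fb')) ] (loop-⊆ loop (p─q⊆p _ _ b∈))
    where
    fb' : First b _
    fb' = first-skip (∉D⇒independent (x∈p─q⇒x∉q b∈)) fb pull

  edge-toward : ∀ {n a u} → IFSWitness n (a ∷ u) →
                ∃₂ λ e r → Pull e (a ∷ u) r × ∃[ n' ] (Edge n e n' × IFSWitness n' r)
  edge-toward {_ , Sl} {a} {u} (mr , disj) with least (λ b → first? b (a ∷ u)) (u , here)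
  ... | e , (r , pull) , e-least with maximal-run-pull pull mr
  ... | s' , st , mr' with loop-reaches Sl (x∈p∧x∉q⇒x∈p─q (step⇒enabled st) (disj (r , pull)))
  ... | Sl' , loop = e , r , pull , _ , edge loop st (witness⇒IFS w) , w
    where
    w : IFSWitness (s' , Sl' ─ D e) r
    w = mr' , child-disjoint loop pull disj e-least

  MaximalTreeRunFrom : Node → List Action → Set
  MaximalTreeRunFrom n v = ∃[ n' ] (TreeRun n v n' × TreeTerminal n')

  terminal⇒leaf : ∀ {s Sl} → Terminal s → TreeTerminal (s , Sl)
  terminal⇒leaf T e _ (edge _ st _) = contradiction (trans (sym st) (T e)) λ ()

  tree-covers : ∀ {n u} → IFSWitness n u → ∃[ v ] (MaximalTreeRunFrom n v × v ∼ u)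
  tree-covers {u = u} = go (length u) refl
    where
    go : ∀ k {n u} → length u ≡ k → IFSWitness n u → ∃[ v ] (MaximalTreeRunFrom n v × v ∼ u)
    go _       {u = []}    _  ((_ , [] , T) , _) = [] , (_ , [] , terminal⇒leaf T) , ε
    go zero    {u = _ ∷ _} ()
    go (suc k) {u = _ ∷ _} len w with edge-toward w
    ... | e , r , pull , _ , n→n' , w' with go k (suc-injective (trans (∼-length (pull-∼ pull)) len)) w'
    ... | v , (_ , tr , leaf) , v∼r = e ∷ v , (_ , n→n' ∷ tr , leaf) , ∼-cons v∼r ◅◅ pull-∼ pull

  leaf-terminal : ∀ {n} → NodeIFS n → TreeTerminal n → Terminal (proj₁ n)
  leaf-terminal ifs leaf with IFS⇒witness ifs
  ... | [] , (_ , [] , T) , _ = T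
  ... | _ ∷ _ , w with edge-toward w
  ... | _ , _ , _ , _ , n→n' , _ = contradiction n→n' (leaf _ _)

  treeRun⇒run : ∀ {n v n'} → TreeRun n v n' → Run (proj₁ n) v (proj₁ n')
  treeRun⇒run []                 = []
  treeRun⇒run (edge _ st _ ∷ tr) = st ∷ treeRun⇒run tr

  treeRun-IFS : ∀ {n v n'} → TreeRun n v n' → NodeIFS n → NodeIFS n'
  treeRun-IFS []                  ifs = ifs
  treeRun-IFS (edge _ _ ifs ∷ tr) _   = treeRun-IFS tr ifs

  treeRun-disjoint : ∀ {n v n'} → TreeRun n v n' → FirstDisjoint v (proj₂ n)
  treeRun-disjoint []                   (_ , ())
  treeRun-disjoint (edge loop _ _ ∷ _)  (_ , here)     b∈Sl =
    x∈p─q⇒x∉q (loop-chosen loop) (loop-⊇ loop b∈Sl)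
  treeRun-disjoint (edge loop _ _ ∷ tr) (_ , skip i p) b∈Sl =
    treeRun-disjoint tr (_ , p) (x∈p∧x∉q⇒x∈p─q (loop-⊇ loop b∈Sl) (independent⇒∉D i))

  treeRun-lex : ∀ {n v n'} → TreeRun n v n' → LexSeq v
  treeRun-lex [] = lexSeq-[]
  treeRun-lex {v = e ∷ y} run@(edge {Sl = Sl} loop _ _ ∷ tr) = lexSeq-∷ e-least (treeRun-lex tr)
    where
    -- A smaller action that commutes to the front was put to sleep before e was chosen,
    -- and, being independent of e, it is still asleep below the e-edge.
    e-least : ∀ {b w} → (b ∷ w) ∼ (e ∷ y) → e F.≤ b
    e-least {b} bw∼ey with ∼⇒first bw∼ey
    ... | _ , here = ≤-refl
    ... | _ , skip i p with b F.<? e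
    ... | no b≮e  = ≮⇒≥ b≮e
    ... | yes b<e = contradiction (x∈p∧x∉q⇒x∈p─q b-asleep (independent⇒∉D i)) (treeRun-disjoint tr (_ , p))
      where
      b-asleep : b ∈ Sl
      b-asleep = loop-below loop (first-enabled (∼⇒first bw∼ey) (treeRun⇒run run)) b<e

  treeFullRun⇒fullLexRun : ∀ v → TreeFullRun v → FullLexRun v
  treeFullRun⇒fullLexRun v (n , tr , leaf) =
    (proj₁ n , treeRun⇒run tr , leaf-terminal (treeRun-IFS tr root-IFS) leaf) , treeRun-lex tr

lemma6p3 : (P : ClientServer) →
    ((v : List (Sem.Action P)) → Sem.TreeFullRun P v → Sem.FullLexRun P v) ×
    ((u : List (Sem.Action P)) → Sem.FullRun P u →
      ∃[ v ] (Sem.TreeFullRun P v × Sem._∼_ P v u ×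
        ((v' : List (Sem.Action P)) → Sem.TreeFullRun P v' → Sem._∼_ P v' u → v' ≡ v)))
lemma6p3 P = treeFullRun⇒fullLexRun , complete
  where
  open Sem P
  open Exploration P

  complete : ∀ u → FullRun u →
    ∃[ v ] (TreeFullRun v × v ∼ u × (∀ v' → TreeFullRun v' → v' ∼ u → v' ≡ v))
  complete u full with tree-covers {root} (full , λ _ → ∉⊥)
  ... | v , tree-full , v∼u = v , tree-full , v∼u , λ v' tree-full' v'∼u →
    lexSeq-unique (proj₂ (treeFullRun⇒fullLexRun v' tree-full')) (proj₂ (treeFullRun⇒fullLexRun v tree-full))
                  (v'∼u ◅◅ ∼-sym v∼u)
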